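{- For every $k\ge 1$, the cactus group $J_{2^k}$ contains an element of order $2^k$.
   Context: For $n \ge 2$, the cactus group $J_n$ is the group with generators $s_{p,q}$ for $1 \le p < q \le n$ and relations: (j1) $s_{p,q}^2 = 1$; (j2) $s_{p,q}s_{m,r} = s_{m,r}s_{p,q}$ whenever $[p,q]\cap[m,r]=\emptyset$; (j3) $s_{p,q}s_{m,r} = s_{p+q-r,\,p+q-m}\,s_{p,q}$ whenever $[m,r]\subset[p,q]$ (intervals of integers). -}

module Defs where

open import Data.Nat using (ℕ; zero; suc; _+_; _∸_; _≤_; _<_)
open import Data.Bool using (Bool; true; false; not)
open import Data.List using (List; []; _∷_; _++_)
open import Data.Sum using (_⊎_)
open import Data.Product using (_×_; _,_; Σ)
open import Relation.Nullary using (¬_)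
open import Relation.Binary.PropositionalEquality using (_≡_)

record Gen (n : ℕ) : Set where
  constructor gen
  field
    p    : ℕ
    q    : ℕ
    1≤p  : 1 ≤ p
    p<q  : p < q
    q≤n  : q ≤ n
open Gen public

-- Letters of the free group on the generators: (true , s) is s, (false , s) is s⁻¹.
Letter : ℕ → Set
Letter n = Bool × Gen n

Word : ℕ → Set
Word n = List (Letter n)

pos : ∀ {n} → Gen n → Letter n
pos s = (true , s)

inv : ∀ {n} → Letter n → Letter n
inv (b , s) = (not b , s)

data Basic {n : ℕ} : Word n → Word n → Set where
  free : (x : Letter n) → Basic (x ∷ inv x ∷ []) []
  j1   : (s : Gen n) → Basic (pos s ∷ pos s ∷ []) []
  j2   : (s t : Gen n) → (q s < p t ⊎ q t < p s) →
         Basic (pos s ∷ pos t ∷ []) (pos t ∷ pos s ∷ [])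
  -- (j3) s_{p,q} s_{m,r} = s_{p+q-r, p+q-m} s_{p,q} when [m,r] ⊆ [p,q]
  j3   : (s t u : Gen n) → p s ≤ p t → q t ≤ q s →
         p u ≡ p s + q s ∸ q t → q u ≡ p s + q s ∸ p t →
         Basic (pos s ∷ pos t ∷ []) (pos u ∷ pos s ∷ [])

data _≈_ {n : ℕ} : Word n → Word n → Set where
  step  : ∀ {l r} (u v : Word n) → Basic l r → (u ++ l ++ v) ≈ (u ++ r ++ v)
  refl  : ∀ {w} → w ≈ w
  sym   : ∀ {w w'} → w ≈ w' → w' ≈ w
  trans : ∀ {w w' w''} → w ≈ w' → w' ≈ w'' → w ≈ w''

_^w_ : ∀ {n} → Word n → ℕ → Word n
w ^w zero  = []
w ^w suc m = w ++ (w ^w m)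

HasOrder : ∀ {n} → Word n → ℕ → Set
HasOrder w m = 1 ≤ m × (w ^w m) ≈ [] × (∀ j → 1 ≤ j → j < m → ¬ ((w ^w j) ≈ []))

{-# OPTIONS --safe #-}
-- J_n acts on {1, …, n} by letting s_{p,q} reverse the interval [p, q]; the relations hold for
-- this action, so a word equal to 1 acts trivially. Let w_k = s_{1,2^k} s_{1,2^(k-1)} ⋯ s_{1,2}
-- and w_{k+1} = s w_k with s = s_{1,2^(k+1)}. By (j3), s w_k s is the mirror image of w_k on the
-- right half of [1, 2^(k+1)], which commutes with w_k by (j2); hence (s w_k)² is the product of two
-- commuting conjugates of w_k, and w_{k+1}^(2^(k+1)) = 1 by induction. Conversely s w_k acts on the
-- left half as w_k at even times and sends it to the right half at odd times, so the point 1 needs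
-- twice as many steps to return under w_{k+1} as under w_k, that is 2^(k+1).
module Submission where

open import Defs
open import Data.Bool using (true; false)
open import Data.Empty using (⊥)
open import Data.List using ([]; _∷_; _++_)
open import Data.List.Properties using (++-assoc; ++-identityʳ)
open import Data.List.Relation.Unary.All as All using (All; []; _∷_)
open import Data.Nat using (ℕ; zero; suc; _+_; _*_; _∸_; _≤_; _<_; _^_; z≤n; s≤s; _≤?_)
open import Data.Nat.GeneralisedArithmetic using (fold; fold-+)
open import Data.Nat.Properties
open import Data.Nat.Tactic.RingSolver using (solve-∀)
open import Data.Product using (_×_; _,_; Σ; ∃-syntax)
open import Data.Sum using (_⊎_; inj₁; inj₂)
open import Function using (_∘_)
open import Level using (0ℓ)
open import Relation.Binary.Bundles using (Setoid)
import Relation.Binary.Reasoning.Setoid as SetoidReasoning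
open import Relation.Binary.PropositionalEquality as Eq using (_≡_; _≢_; cong; cong₂; subst)
open import Relation.Nullary using (¬_; Dec; yes; no; contradiction)
open import Relation.Nullary.Decidable using (_×-dec_)

m+n≡o+p∧n≤p⇒o≤m : ∀ {m n o p} → m + n ≡ o + p → n ≤ p → o ≤ m
m+n≡o+p∧n≤p⇒o≤m {m} {n} {o} eq n≤p =
  +-cancelʳ-≤ n o m (≤-trans (+-monoʳ-≤ o n≤p) (≤-reflexive (Eq.sym eq)))

m≡o∸n⇒m+n≡o : ∀ {m n o} → n ≤ o → m ≡ o ∸ n → m + n ≡ o
m≡o∸n⇒m+n≡o n≤o Eq.refl = m∸n+n≡m n≤o

m+n≡o⇒m≡o∸n : ∀ {m n o} → m + n ≡ o → m ≡ o ∸ n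
m+n≡o⇒m≡o∸n {m} {n} Eq.refl = Eq.sym (m+n∸n≡m m n)

2≤2^suc : ∀ j → 2 ≤ 2 ^ suc j
2≤2^suc j = *-monoʳ-≤ 2 (m^n>0 2 j)

m+2^suc≡m+2^+2^ : ∀ m j → m + 2 ^ suc j ≡ m + 2 ^ j + 2 ^ j
m+2^suc≡m+2^+2^ m j =
  Eq.trans (cong (λ e → m + (2 ^ j + e)) (+-identityʳ (2 ^ j))) (Eq.sym (+-assoc m _ _))

infix 4 _∈[_,_]

_∈[_,_] : ℕ → ℕ → ℕ → Set
x ∈[ p , q ] = p ≤ x × x ≤ q

_∈?[_,_] : (x p q : ℕ) → Dec (x ∈[ p , q ])
x ∈?[ p , q ] = (p ≤? x) ×-dec (x ≤? q)

∈-separated : ∀ {p q p′ q′ x} → q < p′ → x ∈[ p , q ] → ¬ x ∈[ p′ , q′ ]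
∈-separated q<p′ (_ , x≤q) (p′≤x , _) = <⇒≱ q<p′ (≤-trans p′≤x x≤q)

record Mirror (p q m r p′ q′ : ℕ) : Set where
  field
    p≤m      : p ≤ m
    r≤q      : r ≤ q
    p′+r≡p+q : p′ + r ≡ p + q
    q′+m≡p+q : q′ + m ≡ p + q

mirror-refl : ∀ {p q} → Mirror p q p q p q
mirror-refl {p} {q} = record
  { p≤m = ≤-refl ; r≤q = ≤-refl ; p′+r≡p+q = Eq.refl ; q′+m≡p+q = +-comm q p }

module _ {p q m r p′ q′ : ℕ} (mirror : Mirror p q m r p′ q′) where
  open Mirror mirror

  mirror-⊆ : ∀ {x} → x ∈[ m , r ] → x ∈[ p , q ]
  mirror-⊆ (m≤x , x≤r) = ≤-trans p≤m m≤x , ≤-trans x≤r r≤q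

  mirror-sym : Mirror p q p′ q′ m r
  mirror-sym = record
    { p≤m      = m+n≡o+p∧n≤p⇒o≤m p′+r≡p+q r≤q
    ; r≤q      = m+n≡o+p∧n≤p⇒o≤m (Eq.trans (+-comm q p) (Eq.sym q′+m≡p+q)) p≤m
    ; p′+r≡p+q = Eq.trans (+-comm m q′) q′+m≡p+q
    ; q′+m≡p+q = Eq.trans (+-comm r p′) p′+r≡p+q
    }

mirror-blocks : ∀ {a M d y} → a ≤ y → y + d ≡ a + M →
                Mirror (suc a) (a + M) (suc a) (a + d) (suc y) (y + d)
mirror-blocks {a} {M} {d} {y} a≤y y+d≡a+M = record
  { p≤m      = ≤-refl
  ; r≤q      = ≤-trans (+-monoˡ-≤ d a≤y) (≤-reflexive y+d≡a+M)
  ; p′+r≡p+q = Eq.trans (cong suc (swap y a d)) (cong (suc a +_) y+d≡a+M)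
  ; q′+m≡p+q = Eq.trans (+-comm (y + d) (suc a)) (cong (suc a +_) y+d≡a+M)
  }
  where
  swap : ∀ y a d → y + (a + d) ≡ a + (y + d)
  swap = solve-∀

reflect : ℕ → ℕ → ℕ → ℕ
reflect p q x with x ∈?[ p , q ]
... | yes _ = p + q ∸ x
... | no  _ = x

reflect-inside : ∀ {p q x} → x ∈[ p , q ] → reflect p q x + x ≡ p + q
reflect-inside {p} {q} {x} x∈@(_ , x≤q) with x ∈?[ p , q ]
... | yes _  = m∸n+n≡m (≤-trans x≤q (m≤n+m q p))
... | no x∉ = contradiction x∈ x∉

reflect-outside : ∀ {p q x} → ¬ x ∈[ p , q ] → reflect p q x ≡ x
reflect-outside {p} {q} {x} x∉ with x ∈?[ p , q ]
... | yes x∈ = contradiction x∈ x∉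
... | no _   = Eq.refl

reflect-mirror : ∀ {p q m r p′ q′ x} → Mirror p q m r p′ q′ →
                 x ∈[ m , r ] → reflect p q x ∈[ p′ , q′ ]
reflect-mirror {p} {q} {x = x} mirror x∈@(m≤x , x≤r) =
    m+n≡o+p∧n≤p⇒o≤m (Eq.trans y+x≡p+q (Eq.sym p′+r≡p+q)) x≤r
  , m+n≡o+p∧n≤p⇒o≤m (Eq.trans q′+m≡p+q (Eq.sym y+x≡p+q)) m≤x
  where
  open Mirror mirror
  y+x≡p+q : reflect p q x + x ≡ p + q
  y+x≡p+q = reflect-inside (mirror-⊆ mirror x∈)

reflect-∈ : ∀ {p q x} → x ∈[ p , q ] → reflect p q x ∈[ p , q ]
reflect-∈ = reflect-mirror mirror-refl

reflect-involutive : ∀ p q x → reflect p q (reflect p q x) ≡ x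
reflect-involutive p q x = cases (x ∈?[ p , q ])
  where
  cases : Dec (x ∈[ p , q ]) → reflect p q (reflect p q x) ≡ x
  cases (yes x∈) = +-cancelʳ-≡ (reflect p q x) _ _
    (Eq.trans (reflect-inside (reflect-∈ x∈)) (Eq.trans (Eq.sym (reflect-inside x∈)) (+-comm _ x)))
  cases (no x∉) = Eq.trans (cong (reflect p q) (reflect-outside x∉)) (reflect-outside x∉)

reflect-comm : ∀ {p q p′ q′} → q < p′ → ∀ x →
               reflect p q (reflect p′ q′ x) ≡ reflect p′ q′ (reflect p q x)
reflect-comm {p} {q} {p′} {q′} q<p′ x = cases (x ∈?[ p , q ]) (x ∈?[ p′ , q′ ])
  where
  open Eq.≡-Reasoning
  cases : Dec (x ∈[ p , q ]) → Dec (x ∈[ p′ , q′ ]) →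
          reflect p q (reflect p′ q′ x) ≡ reflect p′ q′ (reflect p q x)
  cases (yes x∈) _ = begin
    reflect p q (reflect p′ q′ x)  ≡⟨ cong (reflect p q) (reflect-outside (∈-separated q<p′ x∈)) ⟩
    reflect p q x                  ≡⟨ reflect-outside (∈-separated q<p′ (reflect-∈ x∈)) ⟨
    reflect p′ q′ (reflect p q x)  ∎
  cases (no x∉) (yes x∈′) = begin
    reflect p q (reflect p′ q′ x)  ≡⟨ reflect-outside {p} (λ y∈ → ∈-separated q<p′ y∈ (reflect-∈ x∈′)) ⟩
    reflect p′ q′ x                ≡⟨ cong (reflect p′ q′) (reflect-outside x∉) ⟨
    reflect p′ q′ (reflect p q x)  ∎
  cases (no x∉) (no x∉′) = begin
    reflect p q (reflect p′ q′ x)  ≡⟨ cong (reflect p q) (reflect-outside x∉′) ⟩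
    reflect p q x                  ≡⟨ reflect-outside x∉ ⟩
    x                              ≡⟨ reflect-outside x∉′ ⟨
    reflect p′ q′ x                ≡⟨ cong (reflect p′ q′) (reflect-outside x∉) ⟨
    reflect p′ q′ (reflect p q x)  ∎

reflect-conjugate : ∀ {p q m r p′ q′} → Mirror p q m r p′ q′ → ∀ x →
                    reflect p q (reflect m r x) ≡ reflect p′ q′ (reflect p q x)
reflect-conjugate {p} {q} {m} {r} {p′} {q′} mirror x = cases (x ∈?[ m , r ])
  where
  open Mirror mirror
  open Eq.≡-Reasoning
  cases : Dec (x ∈[ m , r ]) → reflect p q (reflect m r x) ≡ reflect p′ q′ (reflect p q x)
  cases (no x∉) = begin
    reflect p q (reflect m r x)    ≡⟨ cong (reflect p q) (reflect-outside x∉) ⟩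
    reflect p q x                  ≡⟨ reflect-outside y∉ ⟨
    reflect p′ q′ (reflect p q x)  ∎
    where
    y∉ : ¬ reflect p q x ∈[ p′ , q′ ]
    y∉ y∈ = x∉ (subst (_∈[ m , r ]) (reflect-involutive p q x)
                      (reflect-mirror (mirror-sym mirror) y∈))
  cases (yes x∈) = +-cancelʳ-≡ (z + x + y) w v (begin
    w + (z + x + y)        ≡⟨ shuffle₁ w z x y ⟩
    (w + z) + (y + x)      ≡⟨ cong₂ _+_ w+z≡p+q y+x≡p+q ⟩
    (p + q) + (p + q)      ≡⟨ cong₂ _+_ p′+r≡p+q q′+m≡p+q ⟨
    (p′ + r) + (q′ + m)    ≡⟨ shuffle₂ p′ r q′ m ⟩
    (p′ + q′) + (m + r)    ≡⟨ cong₂ _+_ v+y≡p′+q′ z+x≡m+r ⟨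
    (v + y) + (z + x)      ≡⟨ shuffle₃ v y z x ⟩
    v + (z + x + y)        ∎)
    where
    z = reflect m r x
    y = reflect p q x
    w = reflect p q z
    v = reflect p′ q′ y
    w+z≡p+q : w + z ≡ p + q
    w+z≡p+q = reflect-inside (mirror-⊆ mirror (reflect-∈ x∈))
    z+x≡m+r : z + x ≡ m + r
    z+x≡m+r = reflect-inside x∈
    y+x≡p+q : y + x ≡ p + q
    y+x≡p+q = reflect-inside (mirror-⊆ mirror x∈)
    v+y≡p′+q′ : v + y ≡ p′ + q′
    v+y≡p′+q′ = reflect-inside (reflect-mirror mirror x∈)
    shuffle₁ : ∀ w z x y → w + (z + x + y) ≡ (w + z) + (y + x)
    shuffle₁ = solve-∀
    shuffle₂ : ∀ p′ r q′ m → (p′ + r) + (q′ + m) ≡ (p′ + q′) + (m + r)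
    shuffle₂ = solve-∀
    shuffle₃ : ∀ v y z x → (v + y) + (z + x) ≡ v + (z + x + y)
    shuffle₃ = solve-∀

reflect-preserves : ∀ {lo hi p q y} → lo ≤ p → q ≤ hi → y ∈[ lo , hi ] → reflect p q y ∈[ lo , hi ]
reflect-preserves {lo} {hi} {p} {q} {y} lo≤p q≤hi y∈ = cases (y ∈?[ p , q ])
  where
  cases : Dec (y ∈[ p , q ]) → reflect p q y ∈[ lo , hi ]
  cases (yes y∈pq) with reflect-∈ y∈pq
  ... | p≤y′ , y′≤q = ≤-trans lo≤p p≤y′ , ≤-trans y′≤q q≤hi
  cases (no y∉pq)  = subst (_∈[ lo , hi ]) (Eq.sym (reflect-outside y∉pq)) y∈

reflect-fixes : ∀ {lo hi p q y} → lo ≤ p → q ≤ hi → ¬ y ∈[ lo , hi ] → reflect p q y ≡ y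
reflect-fixes lo≤p q≤hi y∉ =
  reflect-outside (λ (p≤y , y≤q) → y∉ (≤-trans lo≤p p≤y , ≤-trans y≤q q≤hi))

NoReturnBefore : {A : Set} → (A → A) → A → ℕ → Set
NoReturnBefore h x m = ∀ j → 1 ≤ j → j < m → fold x h j ≢ x

even-or-odd : ∀ j → ∃[ i ] (j ≡ 2 * i ⊎ j ≡ suc (2 * i))
even-or-odd zero = 0 , inj₁ Eq.refl
even-or-odd (suc j) with even-or-odd j
... | i , inj₁ Eq.refl = i , inj₂ Eq.refl
... | i , inj₂ Eq.refl = suc i , inj₁ (Eq.sym (*-suc 2 i))

-- On P, (f ∘ g)² = g while odd powers of f ∘ g leave P.
module _ {A : Set} {P : A → Set} {f g : A → A}
         (g-preserves : ∀ {y} → P y → P (g y))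
         (g-fixes : ∀ {y} → ¬ P y → g y ≡ y)
         (f-escapes : ∀ {y} → P y → ¬ P (f y))
         (f-involutive : ∀ y → f (f y) ≡ y) where

  fold-preserves : ∀ {y} i → P y → P (fold y g i)
  fold-preserves zero    Py = Py
  fold-preserves (suc i) Py = g-preserves (fold-preserves i Py)

  fold-even : ∀ {y} i → P y → fold y (f ∘ g) (2 * i) ≡ fold y g i
  fold-even zero _ = Eq.refl
  fold-even {y} (suc i) Py = begin
    fold y (f ∘ g) (2 * suc i)          ≡⟨ cong (fold y (f ∘ g)) (*-suc 2 i) ⟩
    fold y (f ∘ g) (2 + 2 * i)          ≡⟨ fold-+ y (f ∘ g) 2 {2 * i} ⟩
    f (g (f (g (fold y (f ∘ g) (2 * i))))) ≡⟨ cong (f ∘ g ∘ f ∘ g) (fold-even i Py) ⟩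
    f (g (f (g z)))                     ≡⟨ cong f (g-fixes (f-escapes (g-preserves Pz))) ⟩
    f (f (g z))                         ≡⟨ f-involutive (g z) ⟩
    g z                                 ∎
    where
    open Eq.≡-Reasoning
    z = fold y g i
    Pz : P z
    Pz = fold-preserves i Py

  fold-odd-escapes : ∀ {y} i → P y → ¬ P (fold y (f ∘ g) (suc (2 * i)))
  fold-odd-escapes i Py P-odd =
    f-escapes (g-preserves (fold-preserves i Py))
              (subst (λ z → P (f (g z))) (fold-even i Py) P-odd)

  no-return-doubles : ∀ {x} m → P x → NoReturnBefore g x m → NoReturnBefore (f ∘ g) x (2 * m)
  no-return-doubles m Px g-no-return j 1≤j j<2m with even-or-odd j
  ... | i , inj₁ Eq.refl = λ returns →
          g-no-return i (positive 1≤j) (*-cancelˡ-< 2 i m j<2m)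
                      (Eq.trans (Eq.sym (fold-even i Px)) returns)
    where
    positive : ∀ {i} → 1 ≤ 2 * i → 1 ≤ i
    positive {suc _} _ = s≤s z≤n
  ... | i , inj₂ Eq.refl = λ returns → fold-odd-escapes i Px (subst P (Eq.sym returns) Px)

≈-setoid : ℕ → Setoid 0ℓ 0ℓ
≈-setoid n = record
  { Carrier       = Word n
  ; _≈_           = _≈_
  ; isEquivalence = record { refl = refl ; sym = sym ; trans = trans }
  }

module ≈-Reasoning {n : ℕ} = SetoidReasoning (≈-setoid n)

module _ {n : ℕ} where

  act : Word n → ℕ → ℕ
  act []            x = x
  act ((_ , s) ∷ w) x = reflect (p s) (q s) (act w x)

  act-++ : ∀ (u v : Word n) x → act (u ++ v) x ≡ act u (act v x)
  act-++ []      v x = Eq.refl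
  act-++ ((_ , s) ∷ u) v x = cong (reflect (p s) (q s)) (act-++ u v x)

  Mirrors : Gen n → Gen n → Gen n → Set
  Mirrors s t u = Mirror (p s) (q s) (p t) (q t) (p u) (q u)

  basic-act : ∀ {l r : Word n} → Basic l r → ∀ x → act l x ≡ act r x
  basic-act (free (_ , s))         x = reflect-involutive (p s) (q s) x
  basic-act (j1 s)                 x = reflect-involutive (p s) (q s) x
  basic-act (j2 s t (inj₁ qs<pt)) x = reflect-comm {p s} {q′ = q t} qs<pt x
  basic-act (j2 s t (inj₂ qt<ps)) x = Eq.sym (reflect-comm {p t} {q′ = q s} qt<ps x)
  basic-act (j3 s t u ps≤pt qt≤qs pu≡ qu≡) x = reflect-conjugate mirror x
    where
    qs≤ps+qs : q s ≤ p s + q s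
    qs≤ps+qs = m≤n+m (q s) (p s)
    mirror : Mirrors s t u
    mirror = record
      { p≤m      = ps≤pt
      ; r≤q      = qt≤qs
      ; p′+r≡p+q = m≡o∸n⇒m+n≡o (≤-trans qt≤qs qs≤ps+qs) pu≡
      ; q′+m≡p+q = m≡o∸n⇒m+n≡o (≤-trans (≤-trans (<⇒≤ (p<q t)) qt≤qs) qs≤ps+qs) qu≡
      }

  ≈⇒act≡ : ∀ {w w′ : Word n} → w ≈ w′ → ∀ x → act w x ≡ act w′ x
  ≈⇒act≡ (step {l} {r} u v basic) x = begin
    act (u ++ l ++ v) x       ≡⟨ act-++ u (l ++ v) x ⟩
    act u (act (l ++ v) x)    ≡⟨ cong (act u) (act-++ l v x) ⟩
    act u (act l (act v x))   ≡⟨ cong (act u) (basic-act basic (act v x)) ⟩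
    act u (act r (act v x))   ≡⟨ cong (act u) (act-++ r v x) ⟨
    act u (act (r ++ v) x)    ≡⟨ act-++ u (r ++ v) x ⟨
    act (u ++ r ++ v) x       ∎
    where open Eq.≡-Reasoning
  ≈⇒act≡ refl          x = Eq.refl
  ≈⇒act≡ (sym e)       x = Eq.sym (≈⇒act≡ e x)
  ≈⇒act≡ (trans e e′)  x = Eq.trans (≈⇒act≡ e x) (≈⇒act≡ e′ x)

  act-^w : ∀ (w : Word n) m x → act (w ^w m) x ≡ fold x (act w) m
  act-^w w zero    x = Eq.refl
  act-^w w (suc m) x = Eq.trans (act-++ w (w ^w m) x) (cong (act w) (act-^w w m x))

  ≡⇒≈ : ∀ {w w′ : Word n} → w ≡ w′ → w ≈ w′
  ≡⇒≈ Eq.refl = refl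

  ++-congˡ : ∀ (u : Word n) {w w′} → w ≈ w′ → (u ++ w) ≈ (u ++ w′)
  ++-congˡ u (step {l} {r} a b basic) =
    Eq.subst₂ _≈_ (++-assoc u a (l ++ b)) (++-assoc u a (r ++ b)) (step (u ++ a) b basic)
  ++-congˡ u refl         = refl
  ++-congˡ u (sym e)      = sym (++-congˡ u e)
  ++-congˡ u (trans e e′) = trans (++-congˡ u e) (++-congˡ u e′)

  ++-congʳ : ∀ (v : Word n) {w w′} → w ≈ w′ → (w ++ v) ≈ (w′ ++ v)
  ++-congʳ v (step {l} {r} a b basic) =
    Eq.subst₂ _≈_ (Eq.sym (reassoc l)) (Eq.sym (reassoc r)) (step a (b ++ v) basic)
    where
    reassoc : ∀ c → (a ++ c ++ b) ++ v ≡ a ++ c ++ (b ++ v)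
    reassoc c = Eq.trans (++-assoc a (c ++ b) v) (cong (a ++_) (++-assoc c b v))
  ++-congʳ v refl         = refl
  ++-congʳ v (sym e)      = sym (++-congʳ v e)
  ++-congʳ v (trans e e′) = trans (++-congʳ v e) (++-congʳ v e′)

  ++-cong : ∀ {w w′ v v′ : Word n} → w ≈ w′ → v ≈ v′ → (w ++ v) ≈ (w′ ++ v′)
  ++-cong {w′ = w′} {v} e e′ = trans (++-congʳ v e) (++-congˡ w′ e′)

  ^w-cong : ∀ {w w′ : Word n} m → w ≈ w′ → (w ^w m) ≈ (w′ ^w m)
  ^w-cong zero    e = refl
  ^w-cong (suc m) e = ++-cong e (^w-cong m e)

  ^w-double : ∀ (w : Word n) m → (w ++ w) ^w m ≡ w ^w (2 * m)
  ^w-double w zero    = Eq.refl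
  ^w-double w (suc m) = begin
    (w ++ w) ++ (w ++ w) ^w m  ≡⟨ cong ((w ++ w) ++_) (^w-double w m) ⟩
    (w ++ w) ++ w ^w (2 * m)   ≡⟨ ++-assoc w w _ ⟩
    w ^w (2 + 2 * m)           ≡⟨ cong (w ^w_) (*-suc 2 m) ⟨
    w ^w (2 * suc m)           ∎
    where open Eq.≡-Reasoning

  ^w-commute : ∀ {X Y : Word n} m → (X ++ Y) ≈ (Y ++ X) → (X ++ Y ^w m) ≈ (Y ^w m ++ X)
  ^w-commute {X} zero    _     = ≡⇒≈ (++-identityʳ X)
  ^w-commute {X} {Y} (suc m) XY≈YX = begin
    X ++ (Y ++ Y ^w m)   ≡⟨ ++-assoc X Y _ ⟨
    (X ++ Y) ++ Y ^w m   ≈⟨ ++-congʳ _ XY≈YX ⟩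
    (Y ++ X) ++ Y ^w m   ≡⟨ ++-assoc Y X _ ⟩
    Y ++ (X ++ Y ^w m)   ≈⟨ ++-congˡ Y (^w-commute m XY≈YX) ⟩
    Y ++ (Y ^w m ++ X)   ≡⟨ ++-assoc Y _ X ⟨
    (Y ++ Y ^w m) ++ X   ∎
    where open ≈-Reasoning

  ^w-++ : ∀ {X Y : Word n} m → (X ++ Y) ≈ (Y ++ X) → ((Y ++ X) ^w m) ≈ (Y ^w m ++ X ^w m)
  ^w-++ zero    _ = refl
  ^w-++ {X} {Y} (suc m) XY≈YX = begin
    (Y ++ X) ++ (Y ++ X) ^w m       ≈⟨ ++-congˡ (Y ++ X) (^w-++ m XY≈YX) ⟩
    (Y ++ X) ++ (Yᵐ ++ Xᵐ)          ≡⟨ ++-assoc Y X _ ⟩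
    Y ++ (X ++ (Yᵐ ++ Xᵐ))          ≡⟨ cong (Y ++_) (++-assoc X Yᵐ Xᵐ) ⟨
    Y ++ ((X ++ Yᵐ) ++ Xᵐ)          ≈⟨ ++-congˡ Y (++-congʳ Xᵐ (^w-commute m XY≈YX)) ⟩
    Y ++ ((Yᵐ ++ X) ++ Xᵐ)          ≡⟨ cong (Y ++_) (++-assoc Yᵐ X Xᵐ) ⟩
    Y ++ (Yᵐ ++ (X ++ Xᵐ))          ≡⟨ ++-assoc Y Yᵐ _ ⟨
    (Y ++ Yᵐ) ++ (X ++ Xᵐ)          ∎
    where
    open ≈-Reasoning
    Xᵐ = X ^w m
    Yᵐ = Y ^w m

  ^w-intertwine : ∀ {X Y S : Word n} m → (Y ++ S) ≈ (S ++ X) → (Y ^w m ++ S) ≈ (S ++ X ^w m)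
  ^w-intertwine {S = S} zero _ = ≡⇒≈ (Eq.sym (++-identityʳ S))
  ^w-intertwine {X} {Y} {S} (suc m) YS≈SX = begin
    (Y ++ Y ^w m) ++ S   ≡⟨ ++-assoc Y _ S ⟩
    Y ++ (Y ^w m ++ S)   ≈⟨ ++-congˡ Y (^w-intertwine m YS≈SX) ⟩
    Y ++ (S ++ X ^w m)   ≡⟨ ++-assoc Y S _ ⟨
    (Y ++ S) ++ X ^w m   ≈⟨ ++-congʳ _ YS≈SX ⟩
    (S ++ X) ++ X ^w m   ≡⟨ ++-assoc S X _ ⟩
    S ++ (X ++ X ^w m)   ∎
    where open ≈-Reasoning

  conjugate-order : ∀ {X Y S : Word n} m → (Y ++ S) ≈ (S ++ X) → (S ++ S) ≈ [] →
                    (X ^w m) ≈ [] → (Y ^w m) ≈ []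
  conjugate-order {X} {Y} {S} m YS≈SX SS≈[] Xᵐ≈[] = begin
    Y ^w m                ≡⟨ ++-identityʳ _ ⟨
    Y ^w m ++ []          ≈⟨ ++-congˡ _ SS≈[] ⟨
    Y ^w m ++ (S ++ S)    ≡⟨ ++-assoc _ S S ⟨
    (Y ^w m ++ S) ++ S    ≈⟨ ++-congʳ S (^w-intertwine m YS≈SX) ⟩
    (S ++ X ^w m) ++ S    ≈⟨ ++-congʳ S (++-congˡ S Xᵐ≈[]) ⟩
    (S ++ []) ++ S        ≡⟨ cong (_++ S) (++-identityʳ S) ⟩
    S ++ S                ≈⟨ SS≈[] ⟩
    []                    ∎
    where open ≈-Reasoning

  -- Inverse letters are excluded: (j2) and (j3) only speak about positive letters.
  LetterWithin : ℕ → ℕ → Letter n → Set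
  LetterWithin lo hi (true  , t) = lo ≤ p t × q t ≤ hi
  LetterWithin lo hi (false , _) = ⊥

  Within : ℕ → ℕ → Word n → Set
  Within lo hi = All (LetterWithin lo hi)

  Within-mono : ∀ {lo hi lo′ hi′} → lo′ ≤ lo → hi ≤ hi′ → ∀ {X} → Within lo hi X → Within lo′ hi′ X
  Within-mono {lo} {hi} {lo′} {hi′} lo′≤lo hi≤hi′ = All.map widen
    where
    widen : ∀ {l} → LetterWithin lo hi l → LetterWithin lo′ hi′ l
    widen {true , _} (lo≤p , q≤hi) = ≤-trans lo′≤lo lo≤p , ≤-trans q≤hi hi≤hi′

  act-within-∈ : ∀ {lo hi} {X : Word n} → Within lo hi X → ∀ {y} → y ∈[ lo , hi ] → act X y ∈[ lo , hi ]
  act-within-∈ {X = []}             []                           y∈ = y∈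
  act-within-∈ {X = (true , t) ∷ X} ((lo≤p , q≤hi) ∷ X-within) y∈ =
    reflect-preserves lo≤p q≤hi (act-within-∈ X-within y∈)

  act-within-fixes : ∀ {lo hi} {X : Word n} → Within lo hi X → ∀ {y} → ¬ y ∈[ lo , hi ] → act X y ≡ y
  act-within-fixes {X = []}             []                           y∉ = Eq.refl
  act-within-fixes {X = (true , t) ∷ X} ((lo≤p , q≤hi) ∷ X-within) y∉ =
    Eq.trans (cong (reflect (p t) (q t)) (act-within-fixes X-within y∉)) (reflect-fixes lo≤p q≤hi y∉)

  commute-letter : ∀ {lo hi lo′ hi′} (l : Letter n) (Y : Word n) →
                   LetterWithin lo hi l → Within lo′ hi′ Y → hi < lo′ → (l ∷ Y) ≈ (Y ++ l ∷ [])
  commute-letter l [] _ [] _ = refl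
  commute-letter (true , t) ((true , u) ∷ Y) t-within@(_ , qt≤hi) ((lo′≤pu , _) ∷ Y-within) hi<lo′ =
    trans (step [] Y (j2 t u (inj₁ (≤-<-trans qt≤hi (<-≤-trans hi<lo′ lo′≤pu)))))
          (++-congˡ (pos u ∷ []) (commute-letter (true , t) Y t-within Y-within hi<lo′))

  separated-commute : ∀ {lo hi lo′ hi′} {X Y : Word n} → Within lo hi X → Within lo′ hi′ Y → hi < lo′ →
                      (X ++ Y) ≈ (Y ++ X)
  separated-commute {Y = Y} [] _ _ = ≡⇒≈ (Eq.sym (++-identityʳ Y))
  separated-commute {X = l ∷ X} {Y} (l-within ∷ X-within) Y-within hi<lo′ = begin
    l ∷ (X ++ Y)         ≈⟨ ++-congˡ (l ∷ []) (separated-commute X-within Y-within hi<lo′) ⟩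
    l ∷ (Y ++ X)         ≈⟨ ++-congʳ X (commute-letter l Y l-within Y-within hi<lo′) ⟩
    (Y ++ l ∷ []) ++ X   ≡⟨ ++-assoc Y (l ∷ []) X ⟩
    Y ++ l ∷ X           ∎
    where open ≈-Reasoning

  data Mirrored (s : Gen n) : Word n → Word n → Set where
    []  : Mirrored s [] []
    _∷_ : ∀ {t u X Y} → Mirrors s t u → Mirrored s X Y → Mirrored s (pos t ∷ X) (pos u ∷ Y)

  mirrored-conjugate : ∀ {s X Y} → Mirrored s X Y → (pos s ∷ X) ≈ (Y ++ pos s ∷ [])
  mirrored-conjugate [] = refl
  mirrored-conjugate {s} (_∷_ {t} {u} {X} mirror rest) =
    trans (step [] X (j3 s t u p≤m r≤q (m+n≡o⇒m≡o∸n p′+r≡p+q) (m+n≡o⇒m≡o∸n q′+m≡p+q)))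
          (++-congˡ (pos u ∷ []) (mirrored-conjugate rest))
    where open Mirror mirror

  -- s X s = Y with X, Y commuting gives (s X)² = Y X, and Y inherits X's order by conjugation.
  order-doubles : ∀ {s X Y} m → Mirrored s X Y → (X ++ Y) ≈ (Y ++ X) → (X ^w m) ≈ [] →
                  ((pos s ∷ X) ^w (2 * m)) ≈ []
  order-doubles {s} {X} {Y} m mirrored XY≈YX Xᵐ≈[] = begin
    (S ++ X) ^w (2 * m)          ≡⟨ ^w-double (S ++ X) m ⟨
    ((S ++ X) ++ (S ++ X)) ^w m  ≈⟨ ^w-cong m square ⟩
    (Y ++ X) ^w m                ≈⟨ ^w-++ m XY≈YX ⟩
    Y ^w m ++ X ^w m             ≈⟨ ++-cong Yᵐ≈[] Xᵐ≈[] ⟩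
    []                           ∎
    where
    open ≈-Reasoning
    S : Word n
    S = pos s ∷ []
    SX≈YS : (S ++ X) ≈ (Y ++ S)
    SX≈YS = mirrored-conjugate mirrored
    SS≈[] : (S ++ S) ≈ []
    SS≈[] = step [] [] (j1 s)
    square : ((S ++ X) ++ (S ++ X)) ≈ (Y ++ X)
    square = begin
      (S ++ X) ++ (S ++ X)   ≈⟨ ++-congʳ (S ++ X) SX≈YS ⟩
      (Y ++ S) ++ (S ++ X)   ≡⟨ ++-assoc Y S _ ⟩
      Y ++ ((S ++ S) ++ X)   ≈⟨ ++-congˡ Y (++-congʳ X SS≈[]) ⟩
      Y ++ X                 ∎
    Yᵐ≈[] : (Y ^w m) ≈ []
    Yᵐ≈[] = conjugate-order m (sym SX≈YS) SS≈[] Xᵐ≈[]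

  block : (a d : ℕ) → 2 ≤ d → a + d ≤ n → Gen n
  block a d 2≤d a+d≤n =
    gen (suc a) (a + d) (s≤s z≤n) (≤-trans (≤-reflexive (+-comm 2 a)) (+-monoʳ-≤ a 2≤d)) a+d≤n

  left-half : ∀ a j → a + 2 ^ suc j ≤ n → a + 2 ^ j ≤ n
  left-half a j = ≤-trans (+-monoʳ-≤ a (m≤m+n (2 ^ j) _))

  right-half : ∀ a j → a + 2 ^ suc j ≤ n → a + 2 ^ j + 2 ^ j ≤ n
  right-half a j = subst (_≤ n) (m+2^suc≡m+2^+2^ a j)

  leftChain : (a j : ℕ) → a + 2 ^ j ≤ n → Word n
  leftChain a zero    _ = []
  leftChain a (suc j) h = pos (block a (2 ^ suc j) (2≤2^suc j) h) ∷ leftChain a j (left-half a j h)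

  rightChain : (a j : ℕ) → a + 2 ^ j ≤ n → Word n
  rightChain a zero    _ = []
  rightChain a (suc j) h =
    pos (block a (2 ^ suc j) (2≤2^suc j) h) ∷ rightChain (a + 2 ^ j) j (right-half a j h)

  leftChain-within : ∀ a j h → Within (suc a) (a + 2 ^ j) (leftChain a j h)
  leftChain-within a zero    _ = []
  leftChain-within a (suc j) h =
    (≤-refl , ≤-refl) ∷ Within-mono ≤-refl (+-monoʳ-≤ a (m≤m+n (2 ^ j) _)) (leftChain-within a j _)

  rightChain-within : ∀ a j h → Within (suc a) (a + 2 ^ j) (rightChain a j h)
  rightChain-within a zero    _ = []
  rightChain-within a (suc j) h =
    (≤-refl , ≤-refl) ∷ Within-mono (s≤s (m≤m+n a _)) (≤-reflexive (Eq.sym (m+2^suc≡m+2^+2^ a j)))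
                                    (rightChain-within (a + 2 ^ j) j _)

  leftChain-mirrored : ∀ {a M} (2≤M : 2 ≤ M) (h : a + M ≤ n) j y hx hy → a ≤ y → y + 2 ^ j ≡ a + M →
                       Mirrored (block a M 2≤M h) (leftChain a j hx) (rightChain y j hy)
  leftChain-mirrored 2≤M h zero    y _  _  _   _ = []
  leftChain-mirrored 2≤M h (suc j) y hx hy a≤y y+2^suc≡ =
    mirror-blocks a≤y y+2^suc≡ ∷
    leftChain-mirrored 2≤M h j (y + 2 ^ j) _ _ (≤-trans a≤y (m≤m+n y _))
                       (Eq.trans (Eq.sym (m+2^suc≡m+2^+2^ y j)) y+2^suc≡)

  leftChain-order-divides : ∀ a j h → (leftChain a j h ^w (2 ^ j)) ≈ []
  leftChain-order-divides a zero    _ = refl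
  leftChain-order-divides a (suc j) h =
    order-doubles (2 ^ j)
      (leftChain-mirrored (2≤2^suc j) h j (a + 2 ^ j) _ (right-half a j h)
                          (m≤m+n a _) (Eq.sym (m+2^suc≡m+2^+2^ a j)))
      (separated-commute (leftChain-within a j _) (rightChain-within (a + 2 ^ j) j _) ≤-refl)
      (leftChain-order-divides a j _)

  leftChain-no-early-return : ∀ a j h → NoReturnBefore (act (leftChain a j h)) (suc a) (2 ^ j)
  leftChain-no-early-return a zero    _ i 1≤i i<1 = contradiction 1≤i (<⇒≱ i<1)
  leftChain-no-early-return a (suc j) h =
    no-return-doubles (act-within-∈ X-within) (act-within-fixes X-within) escapes
                      (reflect-involutive (suc a) (a + 2 ^ suc j)) (2 ^ j) (≤-refl , m<m+n a (m^n>0 2 j))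
                      (leftChain-no-early-return a j _)
    where
    X-within : Within (suc a) (a + 2 ^ j) (leftChain a j (left-half a j h))
    X-within = leftChain-within a j _
    escapes : ∀ {y} → y ∈[ suc a , a + 2 ^ j ] → ¬ reflect (suc a) (a + 2 ^ suc j) y ∈[ suc a , a + 2 ^ j ]
    escapes y∈ y′∈ =
      ∈-separated ≤-refl y′∈
        (reflect-mirror (mirror-blocks (m≤m+n a _) (Eq.sym (m+2^suc≡m+2^+2^ a j))) y∈)

theorem4p4 : (k : ℕ) → 1 ≤ k → Σ (Word (2 ^ k)) (λ w → HasOrder w (2 ^ k))
theorem4p4 k _ = w , m^n>0 2 k , leftChain-order-divides 0 k ≤-refl , no-earlier-power
  where
  w : Word (2 ^ k)
  w = leftChain 0 k ≤-refl
  no-earlier-power : ∀ j → 1 ≤ j → j < 2 ^ k → ¬ ((w ^w j) ≈ [])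
  no-earlier-power j 1≤j j<2^k wʲ≈[] =
    leftChain-no-early-return 0 k ≤-refl j 1≤j j<2^k
      (Eq.trans (Eq.sym (act-^w w j 1)) (≈⇒act≡ wʲ≈[] 1))
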